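{- Let $n\ge2$ be even, $r\in[0,n/2]$ and $s=n/2-r$. Let $S\subseteq\mathbb{Z}_4^n$ be the set of vectors of type $(r,s,r,s)$ and let $G(r,s)$ be the Cayley graph on $\mathbb{Z}_4^n$ with connection set $S$ (vertices $\mathbf{u},\mathbf{w}$ adjacent iff $\mathbf{u}-\mathbf{w}\in S$). For $\mathbf{v}\in\mathbb{Z}_4^n$ of type $(t_0,t_1,t_2,t_3)$, the eigenvalue $\lambda(\mathbf{v})=\sum_{\mathbf{b}\in S}\zeta_4^{\mathbf{b}\cdot\mathbf{v}}$ of $G(r,s)$ (with $\zeta_4=\sqrt{ -1}$) equals $$\lambda(\mathbf{v})=\frac{\binom{n}{r,s,r,s}}{\binom{n}{t_0,t_1,t_2,t_3}}\Big(\big((x+z)^2-(y+w)^2\big)^r\big((x-z)^2+(y-w)^2\big)^s\Big)[t_0,t_1,t_2,t_3].$$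
   Context: For $\mathbf{v}\in\mathbb{Z}_4^n$, its type is $(t_0,t_1,t_2,t_3)$ where $t_k$ is the number of coordinates equal to $k$. $\mathbf{b}\cdot\mathbf{v}=\sum_k b_kv_k\in\mathbb{Z}_4$. The numbers $\lambda(\mathbf{v})$, $\mathbf{v}\in\mathbb{Z}_4^n$, are exactly the eigenvalues of $G(r,s)$, with eigenvectors $(\zeta_4^{\mathbf{v}\cdot\mathbf{b}})_{\mathbf{b}\in\mathbb{Z}_4^n}$. Multinomial coefficients: $\binom{n}{a,b,c,d}=\frac{n!}{a!b!c!d!}$. For a polynomial $f(x,y,z,w)$, $f[t_0,t_1,t_2,t_3]$ is the coefficient of $x^{t_0}y^{t_1}z^{t_2}w^{t_3}$. -}

module Defs where

open import Data.Nat as ℕ using (ℕ; zero; suc; _+_; _*_; _≡ᵇ_; _!; NonZero)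
open import Data.Nat.Properties using (_!≢0; m*n≢0)
open import Data.Nat.DivMod using (_/_)
open import Data.Integer as ℤ using (ℤ; +_; 0ℤ; 1ℤ; -_)
open import Data.Rational as ℚ using (ℚ; 0ℚ)
open import Data.Fin as Fin using (Fin; toℕ)
open import Data.Vec as Vec using (Vec; []; _∷_; count)
open import Data.List as List using (List; []; _∷_; map; concatMap; foldr; allFin; filterᵇ; _++_)
open import Data.Product using (_×_; _,_; proj₁; proj₂)
open import Data.Bool using (Bool; true; false; _∧_; if_then_else_)
open import Relation.Binary.PropositionalEquality using (_≡_)

ℤ₄ : Set
ℤ₄ = Fin 4

ℕ⁴ : Set
ℕ⁴ = ℕ × ℕ × ℕ × ℕ

countEq : ∀ {n} → ℤ₄ → Vec ℤ₄ n → ℕ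
countEq k v = count (Fin._≟ k) v

typeOf : ∀ {n} → Vec ℤ₄ n → ℕ⁴
typeOf v = countEq Fin.zero v , countEq (Fin.suc Fin.zero) v
         , countEq (Fin.suc (Fin.suc Fin.zero)) v , countEq (Fin.suc (Fin.suc (Fin.suc Fin.zero))) v

ℕ⁴-eqᵇ : ℕ⁴ → ℕ⁴ → Bool
ℕ⁴-eqᵇ (a , b , c , d) (a' , b' , c' , d') = (a ≡ᵇ a') ∧ (b ≡ᵇ b') ∧ (c ≡ᵇ c') ∧ (d ≡ᵇ d')

mod4 : ℕ → ℤ₄
mod4 zero = Fin.zero
mod4 (suc zero) = Fin.suc Fin.zero
mod4 (suc (suc zero)) = Fin.suc (Fin.suc Fin.zero)
mod4 (suc (suc (suc zero))) = Fin.suc (Fin.suc (Fin.suc Fin.zero))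
mod4 (suc (suc (suc (suc k)))) = mod4 k

dot : ∀ {n} → Vec ℤ₄ n → Vec ℤ₄ n → ℤ₄
dot b v = mod4 (Vec.sum (Vec.zipWith (λ x y → toℕ x * toℕ y) b v))

allVecs : (n : ℕ) → List (Vec ℤ₄ n)
allVecs zero = [] ∷ []
allVecs (suc n) = concatMap (λ a → map (a ∷_) (allVecs n)) (allFin 4)

connSet : (n r s : ℕ) → List (Vec ℤ₄ n)
connSet n r s = filterᵇ (λ b → ℕ⁴-eqᵇ (typeOf b) (r , s , r , s)) (allVecs n)

-- Gaussian integers ℤ[i] as pairs (real part, imaginary part)

ℤ[i] : Set
ℤ[i] = ℤ × ℤ

_+ᵢ_ : ℤ[i] → ℤ[i] → ℤ[i]
(a , b) +ᵢ (c , d) = (a ℤ.+ c , b ℤ.+ d)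

0ᵢ : ℤ[i]
0ᵢ = (0ℤ , 0ℤ)

ζ₄^ : ℤ₄ → ℤ[i]
ζ₄^ Fin.zero = (1ℤ , 0ℤ)
ζ₄^ (Fin.suc Fin.zero) = (0ℤ , 1ℤ)
ζ₄^ (Fin.suc (Fin.suc Fin.zero)) = (- 1ℤ , 0ℤ)
ζ₄^ (Fin.suc (Fin.suc (Fin.suc Fin.zero))) = (0ℤ , - 1ℤ)

eigenvalue : (n r s : ℕ) → Vec ℤ₄ n → ℤ[i]
eigenvalue n r s v = foldr _+ᵢ_ 0ᵢ (map (λ b → ζ₄^ (dot b v)) (connSet n r s))

multinomial : ℕ → ℕ → ℕ → ℕ → ℕ
multinomial a b c d = ((a + b + c + d) !) / ((a !) * (b !) * (c !) * (d !))
  where instance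
    _ = a !≢0
    _ = b !≢0
    _ = c !≢0
    _ = d !≢0
    _ = m*n≢0 (a !) (b !)
    _ = m*n≢0 (a ! * b !) (c !)
    _ = m*n≢0 (a ! * b ! * c !) (d !)

-- quotient of naturals as a rational (convention: x / 0 = 0; only used
-- with nonzero denominators)
_÷ℕ_ : ℕ → ℕ → ℚ
m ÷ℕ zero = 0ℚ
m ÷ℕ suc k = (+ m) ℚ./ suc k

-- Polynomials in x,y,z,w with integer coefficients, as lists of
-- monomials (coefficient, (exponent of x, y, z, w)).

Poly : Set
Poly = List (ℤ × ℕ⁴)

X Y Z W : Poly
X = (1ℤ , (1 , 0 , 0 , 0)) ∷ []
Y = (1ℤ , (0 , 1 , 0 , 0)) ∷ []
Z = (1ℤ , (0 , 0 , 1 , 0)) ∷ []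
W = (1ℤ , (0 , 0 , 0 , 1)) ∷ []

onePoly : Poly
onePoly = (1ℤ , (0 , 0 , 0 , 0)) ∷ []

_⊕_ : Poly → Poly → Poly
p ⊕ q = p ++ q

⊖_ : Poly → Poly
⊖ p = map (λ { (c , e) → (- c , e) }) p

_⊝_ : Poly → Poly → Poly
p ⊝ q = p ⊕ (⊖ q)

addExp : ℕ⁴ → ℕ⁴ → ℕ⁴
addExp (a , b , c , d) (a' , b' , c' , d') = (a + a' , b + b' , c + c' , d + d')

_⊗_ : Poly → Poly → Poly
p ⊗ q = concatMap (λ { (c , e) → map (λ { (c' , e') → (c ℤ.* c' , addExp e e') }) q }) p

_^ₚ_ : Poly → ℕ → Poly
p ^ₚ zero = onePoly
p ^ₚ suc k = p ⊗ (p ^ₚ k)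

coeff : Poly → ℕ⁴ → ℤ
coeff p t = foldr ℤ._+_ 0ℤ (map proj₁ (filterᵇ (λ m → ℕ⁴-eqᵇ (proj₂ m) t) p))

eigenPoly : ℕ → ℕ → Poly
eigenPoly r s =
  ((((X ⊕ Z) ⊗ (X ⊕ Z)) ⊝ ((Y ⊕ W) ⊗ (Y ⊕ W))) ^ₚ r)
  ⊗ ((((X ⊝ Z) ⊗ (X ⊝ Z)) ⊕ ((Y ⊝ W) ⊗ (Y ⊝ W))) ^ₚ s)

-- For v ∈ ℤ₄ⁿ let 𝒦 v be the series Σ_b ζ^{b·v} x^{type b}.  It is the product, over the letters a
-- of v, of the linear forms x + ζᵃ y + ζ²ᵃ z + ζ³ᵃ w; these commute, so 𝒦 v depends only on the type
-- of v.  Summing ζ^{b·v} over all pairs (b, v) with b of type e = (r,s,r,s) and v of type t in two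
-- ways gives N(t) λ(v) = N(e) [x^t] 𝒦 w for any w of type e, where N counts vectors of a given type
-- and is the multinomial coefficient.  Taking w = (0,2)^r (1,3)^s, the pair products factor as
-- (x+y+z+w)(x−y+z−w) = (x+z)² − (y+w)² and (x+iy−z−iw)(x−iy−z+iw) = (x−z)² + (y−w)², so 𝒦 w is the
-- polynomial of the statement.
module Submission where

open import Defs
open import Data.Nat using (ℕ; _*_; _∸_; _≤_; _≥_)
open import Data.Integer using (0ℤ)
open import Data.Rational using (_/_) renaming (_*_ to _*ℚ_)
open import Data.Fin using (Fin)
open import Data.Vec using (Vec)
open import Data.Product using (_×_; _,_; proj₁; proj₂)
open import Relation.Binary.PropositionalEquality using (_≡_)

open import Algebra.Bundles using (CommutativeRing)
open import Algebra.Structures using (IsCommutativeRing)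
import Algebra.Properties.CommutativeSemigroup as CommutativeSemigroupProperties
import Algebra.Properties.Ring as RingProperties
open import Data.Bool using (Bool; true; false; T; if_then_else_; _∧_)
open import Data.Bool.Properties using (∧-zeroʳ; T-∧; T-≡)
open import Data.Empty using (⊥-elim)
open import Data.Fin using (toℕ)
open import Data.Fin.Patterns using (0F; 1F; 2F; 3F)
open import Data.Integer as ℤ using (ℤ; +_; 1ℤ; -_)
import Data.Integer.Properties as ℤ
open import Data.Integer.Tactic.RingSolver using (solve-∀)
open import Data.List as List using (List; []; _∷_; _++_; map; concatMap; foldr; filterᵇ; allFin)
open import Data.List.Properties using (map-++)
open import Data.Maybe using (Maybe; just; nothing; maybe′; zip; _>>=_)
open import Data.Maybe.Properties using (maybe′-∘)
open import Data.Nat as ℕ using (zero; suc; _+_; _≡ᵇ_; _!)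
import Data.Nat.Properties as ℕ
open import Data.Nat.Properties using (_!≢0)
open import Data.Nat.DivMod as DivMod using (m*n/n≡m)
open import Data.Nat.ListAction using (sum)
open import Data.Nat.Tactic.RingSolver using () renaming (solve-∀ to ℕ-solve-∀)
open import Data.Rational using (toℚᵘ)
import Data.Rational.Properties as ℚ
open import Data.Rational.Unnormalised.Base using (mkℚᵘ; *≡*)
import Data.Rational.Unnormalised.Base as ℚᵘ
import Data.Rational.Unnormalised.Properties as ℚᵘ
open import Data.Vec as Vec using ([]; _∷_)
open import Function using (_∘_)
open import Function.Bundles using (module Equivalence)
open Equivalence using (to; from)
open import Relation.Binary.PropositionalEquality
  using (refl; sym; trans; cong; cong₂; isEquivalence; _≗_; _≢_; module ≡-Reasoning)
import Tactic.RingSolver as RingSolver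
open import Tactic.RingSolver.Core.AlmostCommutativeRing using (AlmostCommutativeRing; fromCommutativeRing)

-- Gaussian integers

-- _+ᵢ_ has the default fixity (20, non-associative), so _*ᵢ_ must bind tighter than 20.
infixl 21 _*ᵢ_
infix  22 -ᵢ_

_*ᵢ_ : ℤ[i] → ℤ[i] → ℤ[i]
(a , b) *ᵢ (c , d) = (a ℤ.* c ℤ.- b ℤ.* d , a ℤ.* d ℤ.+ b ℤ.* c)

-ᵢ_ : ℤ[i] → ℤ[i]
-ᵢ (a , b) = (- a , - b)

1ᵢ : ℤ[i]
1ᵢ = (1ℤ , 0ℤ)

ι : ℤ → ℤ[i]
ι a = (a , 0ℤ)

i : ℤ[i]
i = (0ℤ , 1ℤ)

+ᵢ-*ᵢ-isCommutativeRing : IsCommutativeRing _≡_ _+ᵢ_ _*ᵢ_ -ᵢ_ 0ᵢ 1ᵢ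
+ᵢ-*ᵢ-isCommutativeRing = record
  { isRing = record
    { +-isAbelianGroup = record
      { isGroup = record
        { isMonoid = record
          { isSemigroup = record
            { isMagma = record { isEquivalence = isEquivalence ; ∙-cong = cong₂ _+ᵢ_ }
            ; assoc   = λ (a , b) (c , d) (e , f) → cong₂ _,_ (ℤ.+-assoc a c e) (ℤ.+-assoc b d f)
            }
          ; identity = (λ (a , b) → cong₂ _,_ (ℤ.+-identityˡ a) (ℤ.+-identityˡ b))
                     , (λ (a , b) → cong₂ _,_ (ℤ.+-identityʳ a) (ℤ.+-identityʳ b))
          }
        ; inverse = (λ (a , b) → cong₂ _,_ (ℤ.+-inverseˡ a) (ℤ.+-inverseˡ b))
                  , (λ (a , b) → cong₂ _,_ (ℤ.+-inverseʳ a) (ℤ.+-inverseʳ b))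
        ; ⁻¹-cong = cong -ᵢ_
        }
      ; comm = λ (a , b) (c , d) → cong₂ _,_ (ℤ.+-comm a c) (ℤ.+-comm b d)
      }
    ; *-cong     = cong₂ _*ᵢ_
    ; *-assoc    = *ᵢ-assoc
    ; *-identity = *ᵢ-identityˡ , λ x → trans (*ᵢ-comm x 1ᵢ) (*ᵢ-identityˡ x)
    ; distrib    = *ᵢ-distribˡ , λ x y z → trans (*ᵢ-comm (y +ᵢ z) x)
                                           (trans (*ᵢ-distribˡ x y z) (cong₂ _+ᵢ_ (*ᵢ-comm x y) (*ᵢ-comm x z)))
    }
  ; *-comm = *ᵢ-comm
  }
  where
  *ᵢ-assoc : ∀ x y z → (x *ᵢ y) *ᵢ z ≡ x *ᵢ (y *ᵢ z)
  *ᵢ-assoc (a , b) (c , d) (e , f) = cong₂ _,_ (re a b c d e f) (im a b c d e f)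
    where
    re : ∀ a b c d e f → (a ℤ.* c ℤ.- b ℤ.* d) ℤ.* e ℤ.- (a ℤ.* d ℤ.+ b ℤ.* c) ℤ.* f
                       ≡ a ℤ.* (c ℤ.* e ℤ.- d ℤ.* f) ℤ.- b ℤ.* (c ℤ.* f ℤ.+ d ℤ.* e)
    re = solve-∀
    im : ∀ a b c d e f → (a ℤ.* c ℤ.- b ℤ.* d) ℤ.* f ℤ.+ (a ℤ.* d ℤ.+ b ℤ.* c) ℤ.* e
                       ≡ a ℤ.* (c ℤ.* f ℤ.+ d ℤ.* e) ℤ.+ b ℤ.* (c ℤ.* e ℤ.- d ℤ.* f)
    im = solve-∀
  *ᵢ-comm : ∀ x y → x *ᵢ y ≡ y *ᵢ x
  *ᵢ-comm (a , b) (c , d) = cong₂ _,_ (re a b c d) (im a b c d)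
    where
    re : ∀ a b c d → a ℤ.* c ℤ.- b ℤ.* d ≡ c ℤ.* a ℤ.- d ℤ.* b
    re = solve-∀
    im : ∀ a b c d → a ℤ.* d ℤ.+ b ℤ.* c ≡ c ℤ.* b ℤ.+ d ℤ.* a
    im = solve-∀
  *ᵢ-identityˡ : ∀ x → 1ᵢ *ᵢ x ≡ x
  *ᵢ-identityˡ (a , b) = cong₂ _,_ (re a b) (im a b)
    where
    re : ∀ a b → 1ℤ ℤ.* a ℤ.- 0ℤ ℤ.* b ≡ a
    re = solve-∀
    im : ∀ a b → 1ℤ ℤ.* b ℤ.+ 0ℤ ℤ.* a ≡ b
    im = solve-∀
  *ᵢ-distribˡ : ∀ x y z → x *ᵢ (y +ᵢ z) ≡ x *ᵢ y +ᵢ x *ᵢ z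
  *ᵢ-distribˡ (a , b) (c , d) (e , f) = cong₂ _,_ (re a b c d e f) (im a b c d e f)
    where
    re : ∀ a b c d e f → a ℤ.* (c ℤ.+ e) ℤ.- b ℤ.* (d ℤ.+ f)
                       ≡ (a ℤ.* c ℤ.- b ℤ.* d) ℤ.+ (a ℤ.* e ℤ.- b ℤ.* f)
    re = solve-∀
    im : ∀ a b c d e f → a ℤ.* (d ℤ.+ f) ℤ.+ b ℤ.* (c ℤ.+ e)
                       ≡ (a ℤ.* d ℤ.+ b ℤ.* c) ℤ.+ (a ℤ.* f ℤ.+ b ℤ.* e)
    im = solve-∀

ℤ[i]-commutativeRing : CommutativeRing _ _
ℤ[i]-commutativeRing = record { isCommutativeRing = +ᵢ-*ᵢ-isCommutativeRing }

ℤ[i]-ring : AlmostCommutativeRing _ _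
ℤ[i]-ring = fromCommutativeRing ℤ[i]-commutativeRing λ
  { (+ 0 , + 0) → just refl
  ; _ → nothing }

module ℤ[i] where
  open CommutativeRing ℤ[i]-commutativeRing public
  open RingProperties ring public
  open CommutativeSemigroupProperties *-commutativeSemigroup public using (x∙yz≈y∙xz)

ι-* : ∀ a b → ι (a ℤ.* b) ≡ ι a *ᵢ ι b
ι-* a b = cong₂ _,_ (re a b) (im a b)
  where
  re : ∀ a b → a ℤ.* b ≡ a ℤ.* b ℤ.- 0ℤ ℤ.* 0ℤ
  re = solve-∀
  im : ∀ a b → 0ℤ ≡ a ℤ.* 0ℤ ℤ.+ 0ℤ ℤ.* b
  im = solve-∀

ι-scale : ∀ a z → ι a *ᵢ z ≡ (a ℤ.* proj₁ z , a ℤ.* proj₂ z)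
ι-scale a (x , y) = cong₂ _,_ (re a x y) (im a x y)
  where
  re : ∀ a x y → a ℤ.* x ℤ.- 0ℤ ℤ.* y ≡ a ℤ.* x
  re = solve-∀
  im : ∀ a x y → a ℤ.* y ℤ.+ 0ℤ ℤ.* x ≡ a ℤ.* y
  im = solve-∀

-- Finite sums

𝟙 : Bool → ℤ[i]
𝟙 b = if b then 1ᵢ else 0ᵢ

∑ : {A : Set} → (A → ℤ[i]) → List A → ℤ[i]
∑ f xs = foldr _+ᵢ_ 0ᵢ (map f xs)

module _ {A : Set} where

  ∑-cong : {f g : A → ℤ[i]} → f ≗ g → ∀ xs → ∑ f xs ≡ ∑ g xs
  ∑-cong f≗g [] = refl
  ∑-cong f≗g (x ∷ xs) = cong₂ _+ᵢ_ (f≗g x) (∑-cong f≗g xs)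

  ∑-++ : ∀ (f : A → ℤ[i]) xs ys → ∑ f (xs ++ ys) ≡ ∑ f xs +ᵢ ∑ f ys
  ∑-++ f [] ys = sym (ℤ[i].+-identityˡ (∑ f ys))
  ∑-++ f (x ∷ xs) ys = trans (cong (f x +ᵢ_) (∑-++ f xs ys)) (sym (ℤ[i].+-assoc (f x) (∑ f xs) (∑ f ys)))

  ∑-zero : ∀ xs → ∑ {A} (λ _ → 0ᵢ) xs ≡ 0ᵢ
  ∑-zero [] = refl
  ∑-zero (x ∷ xs) = trans (cong (0ᵢ +ᵢ_) (∑-zero xs)) (ℤ[i].+-identityˡ 0ᵢ)

  ∑-+ : ∀ (f g : A → ℤ[i]) xs → ∑ (λ x → f x +ᵢ g x) xs ≡ ∑ f xs +ᵢ ∑ g xs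
  ∑-+ f g [] = sym (ℤ[i].+-identityˡ 0ᵢ)
  ∑-+ f g (x ∷ xs) = trans (cong ((f x +ᵢ g x) +ᵢ_) (∑-+ f g xs)) (interchange (f x) (g x) (∑ f xs) (∑ g xs))
    where
    interchange : ∀ a b c d → (a +ᵢ b) +ᵢ (c +ᵢ d) ≡ (a +ᵢ c) +ᵢ (b +ᵢ d)
    interchange = RingSolver.solve-∀ ℤ[i]-ring

  ∑-*ˡ : ∀ k (f : A → ℤ[i]) xs → ∑ (λ x → k *ᵢ f x) xs ≡ k *ᵢ ∑ f xs
  ∑-*ˡ k f [] = sym (ℤ[i].zeroʳ k)
  ∑-*ˡ k f (x ∷ xs) = trans (cong (k *ᵢ f x +ᵢ_) (∑-*ˡ k f xs)) (sym (ℤ[i].distribˡ k (f x) (∑ f xs)))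

  ∑-*ʳ : ∀ (f : A → ℤ[i]) k xs → ∑ (λ x → f x *ᵢ k) xs ≡ ∑ f xs *ᵢ k
  ∑-*ʳ f k xs = trans (∑-cong (λ x → ℤ[i].*-comm (f x) k) xs) (trans (∑-*ˡ k f xs) (ℤ[i].*-comm k (∑ f xs)))

  ∑-neg : ∀ (f : A → ℤ[i]) xs → ∑ (λ x → -ᵢ f x) xs ≡ -ᵢ ∑ f xs
  ∑-neg f [] = refl
  ∑-neg f (x ∷ xs) = trans (cong (-ᵢ f x +ᵢ_) (∑-neg f xs)) (ℤ[i].-‿+-comm (f x) (∑ f xs))

  ∑-filterᵇ : ∀ (p : A → Bool) (f : A → ℤ[i]) xs → ∑ f (filterᵇ p xs) ≡ ∑ (λ x → 𝟙 (p x) *ᵢ f x) xs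
  ∑-filterᵇ p f [] = refl
  ∑-filterᵇ p f (x ∷ xs) with p x
  ... | true  = cong₂ _+ᵢ_ (sym (ℤ[i].*-identityˡ (f x))) (∑-filterᵇ p f xs)
  ... | false = trans (∑-filterᵇ p f xs) (sym (trans (cong (_+ᵢ ∑ (λ x → 𝟙 (p x) *ᵢ f x) xs) (ℤ[i].zeroˡ (f x)))
                                                     (ℤ[i].+-identityˡ _)))

module _ {A B : Set} where

  ∑-map : ∀ (f : B → ℤ[i]) (g : A → B) xs → ∑ f (map g xs) ≡ ∑ (λ x → f (g x)) xs
  ∑-map f g [] = refl
  ∑-map f g (x ∷ xs) = cong (f (g x) +ᵢ_) (∑-map f g xs)

  ∑-concatMap : ∀ (f : B → ℤ[i]) (g : A → List B) xs → ∑ f (concatMap g xs) ≡ ∑ (λ x → ∑ f (g x)) xs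
  ∑-concatMap f g [] = refl
  ∑-concatMap f g (x ∷ xs) = trans (∑-++ f (g x) (concatMap g xs)) (cong (∑ f (g x) +ᵢ_) (∑-concatMap f g xs))

  ∑-comm : ∀ (f : A → B → ℤ[i]) xs ys → ∑ (λ x → ∑ (f x) ys) xs ≡ ∑ (λ y → ∑ (λ x → f x y) xs) ys
  ∑-comm f [] ys = sym (∑-zero ys)
  ∑-comm f (x ∷ xs) ys = trans (cong (∑ (f x) ys +ᵢ_) (∑-comm f xs ys))
                               (sym (∑-+ (f x) (λ y → ∑ (λ x → f x y) xs) ys))

ι-∑ : ∀ {A : Set} (f : A → ℤ) xs → ι (foldr ℤ._+_ 0ℤ (map f xs)) ≡ ∑ (ι ∘ f) xs
ι-∑ f [] = refl
ι-∑ f (x ∷ xs) = cong (ι (f x) +ᵢ_) (ι-∑ f xs)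

ι+-sum : ∀ {A : Set} (f : A → ℕ) xs → ι (+ sum (map f xs)) ≡ ∑ (λ x → ι (+ f x)) xs
ι+-sum f []       = refl
ι+-sum f (x ∷ xs) = cong (ι (+ f x) +ᵢ_) (ι+-sum f xs)

-- Exponents and shifts of coefficient series

_∸?_ : ℕ → ℕ → Maybe ℕ
m     ∸? zero  = just m
zero  ∸? suc n = nothing
suc m ∸? suc n = m ∸? n

∸?-+ : ∀ m n k → m ∸? (n + k) ≡ ((m ∸? n) >>= (_∸? k))
∸?-+ m     zero    k = refl
∸?-+ zero  (suc n) k = refl
∸?-+ (suc m) (suc n) k = ∸?-+ m n k

+-∸? : ∀ m n → (m + n) ∸? m ≡ just n
+-∸? zero    n = refl
+-∸? (suc m) n = +-∸? m n

≡ᵇ-+ : ∀ m n k → (m + n ≡ᵇ k) ≡ maybe′ (n ≡ᵇ_) false (k ∸? m)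
≡ᵇ-+ zero    n k       = refl
≡ᵇ-+ (suc m) n zero    = refl
≡ᵇ-+ (suc m) n (suc k) = ≡ᵇ-+ m n k

module _ {A B C D : Set} where

  zip->>= : ∀ (m : Maybe A) (n : Maybe B) (f : A → Maybe C) (g : B → Maybe D) →
            zip (m >>= f) (n >>= g) ≡ (zip m n >>= λ (a , b) → zip (f a) (g b))
  zip->>= nothing  n        f g = refl
  zip->>= (just a) (just b) f g = refl
  zip->>= (just a) nothing  f g with f a
  ... | nothing = refl
  ... | just _  = refl

maybe′-zip-∧ : ∀ {A B : Set} (f : A → Bool) (g : B → Bool) m n →
               maybe′ (λ (a , b) → f a ∧ g b) false (zip m n) ≡ maybe′ f false m ∧ maybe′ g false n
maybe′-zip-∧ f g nothing  n        = refl
maybe′-zip-∧ f g (just a) (just b) = refl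
maybe′-zip-∧ f g (just a) nothing  = sym (∧-zeroʳ (f a))

_∸⁴?_ : ℕ⁴ → ℕ⁴ → Maybe ℕ⁴
(t₀ , t₁ , t₂ , t₃) ∸⁴? (e₀ , e₁ , e₂ , e₃) =
  zip (t₀ ∸? e₀) (zip (t₁ ∸? e₁) (zip (t₂ ∸? e₂) (t₃ ∸? e₃)))

∸⁴?-addExp : ∀ t e e' → t ∸⁴? addExp e e' ≡ ((t ∸⁴? e) >>= (_∸⁴? e'))
∸⁴?-addExp (t₀ , t₁ , t₂ , t₃) (e₀ , e₁ , e₂ , e₃) (e₀' , e₁' , e₂' , e₃')
  rewrite ∸?-+ t₀ e₀ e₀' | ∸?-+ t₁ e₁ e₁' | ∸?-+ t₂ e₂ e₂' | ∸?-+ t₃ e₃ e₃' =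
  trans (cong (zip _) (trans (cong (zip _) (zip->>= (t₂ ∸? e₂) (t₃ ∸? e₃) _ _)) (zip->>= (t₁ ∸? e₁) _ _ _)))
        (zip->>= (t₀ ∸? e₀) _ _ _)

ℕ⁴-eqᵇ-addExp : ∀ e t u → ℕ⁴-eqᵇ (addExp e t) u ≡ maybe′ (ℕ⁴-eqᵇ t) false (u ∸⁴? e)
ℕ⁴-eqᵇ-addExp (e₀ , e₁ , e₂ , e₃) (t₀ , t₁ , t₂ , t₃) (u₀ , u₁ , u₂ , u₃)
  rewrite ≡ᵇ-+ e₀ t₀ u₀ | ≡ᵇ-+ e₁ t₁ u₁ | ≡ᵇ-+ e₂ t₂ u₂ | ≡ᵇ-+ e₃ t₃ u₃ =
  sym (trans (maybe′-zip-∧ (t₀ ≡ᵇ_) _ (u₀ ∸? e₀) _)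
      (cong (_ ∧_) (trans (maybe′-zip-∧ (t₁ ≡ᵇ_) _ (u₁ ∸? e₁) _)
                          (cong (_ ∧_) (maybe′-zip-∧ (t₂ ≡ᵇ_) (t₃ ≡ᵇ_) (u₂ ∸? e₂) _)))))

addExp-comm : ∀ e e' → addExp e e' ≡ addExp e' e
addExp-comm (a₀ , a₁ , a₂ , a₃) (b₀ , b₁ , b₂ , b₃)
  rewrite ℕ.+-comm a₀ b₀ | ℕ.+-comm a₁ b₁ | ℕ.+-comm a₂ b₂ | ℕ.+-comm a₃ b₃ = refl

addExp-identityʳ : ∀ e → addExp e (0 , 0 , 0 , 0) ≡ e
addExp-identityʳ (e₀ , e₁ , e₂ , e₃)
  rewrite ℕ.+-identityʳ e₀ | ℕ.+-identityʳ e₁ | ℕ.+-identityʳ e₂ | ℕ.+-identityʳ e₃ = refl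

-- A series in x, y, z, w is its coefficient function ℕ⁴ → A; shift z e F is x^e F, where z is the zero of A.
shift : {A : Set} → A → ℕ⁴ → (ℕ⁴ → A) → ℕ⁴ → A
shift z e F t = maybe′ F z (t ∸⁴? e)

module _ {A : Set} (z : A) where

  shift-cong : ∀ e {F G : ℕ⁴ → A} → F ≗ G → shift z e F ≗ shift z e G
  shift-cong e F≗G t with t ∸⁴? e
  ... | nothing = refl
  ... | just u  = F≗G u

  shift-shift : ∀ e e' F → shift z e (shift z e' F) ≗ shift z (addExp e e') F
  shift-shift e e' F t rewrite ∸⁴?-addExp t e e' with t ∸⁴? e
  ... | nothing = refl
  ... | just _  = refl

shift-natural : ∀ {A B : Set} (h : A → B) z e F → h ∘ shift z e F ≗ shift (h z) e (h ∘ F)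
shift-natural h z e F t = maybe′-∘ h F (t ∸⁴? e)

shift-addExp : ∀ {A : Set} (z : A) e F u → shift z e F (addExp e u) ≡ F u
shift-addExp z (e₀ , e₁ , e₂ , e₃) F (u₀ , u₁ , u₂ , u₃)
  rewrite +-∸? e₀ u₀ | +-∸? e₁ u₁ | +-∸? e₂ u₂ | +-∸? e₃ u₃ = refl

Series : Set
Series = ℕ⁴ → ℤ[i]

shift-*ˡ : ∀ k e (F : Series) t → shift 0ᵢ e (λ u → k *ᵢ F u) t ≡ k *ᵢ shift 0ᵢ e F t
shift-*ˡ k e F t = sym (trans (shift-natural (k *ᵢ_) 0ᵢ e F t)
                              (cong (λ z → shift z e (λ u → k *ᵢ F u) t) (ℤ[i].zeroʳ k)))

shift-+ : ∀ e (F G : Series) t → shift 0ᵢ e (λ u → F u +ᵢ G u) t ≡ shift 0ᵢ e F t +ᵢ shift 0ᵢ e G t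
shift-+ e F G t with t ∸⁴? e
... | nothing = refl
... | just _  = refl

shift-∑ : ∀ {A : Set} e (F : A → Series) xs t →
          shift 0ᵢ e (λ u → ∑ (λ x → F x u) xs) t ≡ ∑ (λ x → shift 0ᵢ e (F x) t) xs
shift-∑ e F xs t with t ∸⁴? e
... | nothing = sym (∑-zero xs)
... | just _  = refl

shift-𝟙 : ∀ e P k t → shift 0ᵢ e (λ u → 𝟙 (P u) *ᵢ k) t ≡ 𝟙 (shift false e P t) *ᵢ k
shift-𝟙 e P k t with t ∸⁴? e
... | nothing = sym (ℤ[i].zeroˡ k)
... | just _  = refl

-- Multiplying series by polynomials

-- Polynomials with Gaussian coefficients, as lists of monomials; p ⋆ F is the product of p with the series F.
Polyᵢ : Set
Polyᵢ = List (ℤ[i] × ℕ⁴)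

infixr 9 _⋆_

_⋆_ : Polyᵢ → Series → Series
(p ⋆ F) t = ∑ (λ (c , e) → c *ᵢ shift 0ᵢ e F t) p

⋆-cong : ∀ p {F G} → F ≗ G → p ⋆ F ≗ p ⋆ G
⋆-cong p F≗G t = ∑-cong (λ (c , e) → cong (c *ᵢ_) (shift-cong 0ᵢ e F≗G t)) p

⋆-++ : ∀ p q F t → ((p ++ q) ⋆ F) t ≡ (p ⋆ F) t +ᵢ (q ⋆ F) t
⋆-++ p q F t = ∑-++ _ p q

⋆-+ : ∀ p F G t → (p ⋆ λ u → F u +ᵢ G u) t ≡ (p ⋆ F) t +ᵢ (p ⋆ G) t
⋆-+ p F G t = trans (∑-cong (λ (c , e) → trans (cong (c *ᵢ_) (shift-+ e F G t)) (ℤ[i].distribˡ c _ _)) p)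
                    (∑-+ _ _ p)

⋆-*ˡ : ∀ p k F t → (p ⋆ λ u → k *ᵢ F u) t ≡ k *ᵢ (p ⋆ F) t
⋆-*ˡ p k F t = trans (∑-cong (λ (c , e) → trans (cong (c *ᵢ_) (shift-*ˡ k e F t)) (ℤ[i].x∙yz≈y∙xz c k _)) p)
                     (∑-*ˡ k _ p)

⋆-⋆ : ∀ p q F t →
      (p ⋆ q ⋆ F) t ≡ ∑ (λ (c , e) → ∑ (λ (c' , e') → (c *ᵢ c') *ᵢ shift 0ᵢ (addExp e e') F t) q) p
⋆-⋆ p q F t = ∑-cong monomial p
  where
  open ≡-Reasoning
  monomial : ∀ ((c , e) : ℤ[i] × ℕ⁴) →
             c *ᵢ shift 0ᵢ e (q ⋆ F) t ≡ ∑ (λ (c' , e') → (c *ᵢ c') *ᵢ shift 0ᵢ (addExp e e') F t) q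
  monomial (c , e) = begin
    c *ᵢ shift 0ᵢ e (q ⋆ F) t
      ≡⟨ cong (c *ᵢ_) (shift-∑ e (λ (c' , e') u → c' *ᵢ shift 0ᵢ e' F u) q t) ⟩
    c *ᵢ ∑ (λ (c' , e') → shift 0ᵢ e (λ u → c' *ᵢ shift 0ᵢ e' F u) t) q
      ≡⟨ sym (∑-*ˡ c _ q) ⟩
    ∑ (λ (c' , e') → c *ᵢ shift 0ᵢ e (λ u → c' *ᵢ shift 0ᵢ e' F u) t) q
      ≡⟨ ∑-cong (λ (c' , e') → cong (c *ᵢ_) (trans (shift-*ˡ c' e _ t)
                                                   (cong (c' *ᵢ_) (shift-shift 0ᵢ e e' F t)))) q ⟩
    ∑ (λ (c' , e') → c *ᵢ (c' *ᵢ shift 0ᵢ (addExp e e') F t)) q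
      ≡⟨ ∑-cong (λ (c' , e') → sym (ℤ[i].*-assoc c c' _)) q ⟩
    ∑ (λ (c' , e') → (c *ᵢ c') *ᵢ shift 0ᵢ (addExp e e') F t) q ∎

⋆-comm : ∀ p q F → p ⋆ q ⋆ F ≗ q ⋆ p ⋆ F
⋆-comm p q F t = begin
  (p ⋆ q ⋆ F) t                                                                        ≡⟨ ⋆-⋆ p q F t ⟩
  ∑ (λ (c , e) → ∑ (λ (c' , e') → (c *ᵢ c') *ᵢ shift 0ᵢ (addExp e e') F t) q) p   ≡⟨ ∑-comm _ p q ⟩
  ∑ (λ (c' , e') → ∑ (λ (c , e) → (c *ᵢ c') *ᵢ shift 0ᵢ (addExp e e') F t) p) q   ≡⟨ ∑-cong swap q ⟩
  ∑ (λ (c' , e') → ∑ (λ (c , e) → (c' *ᵢ c) *ᵢ shift 0ᵢ (addExp e' e) F t) p) q   ≡⟨ ⋆-⋆ q p F t ⟨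
  (q ⋆ p ⋆ F) t                                                                        ∎
  where
  open ≡-Reasoning
  swap : ∀ ((c' , e') : ℤ[i] × ℕ⁴) → ∑ (λ (c , e) → (c *ᵢ c') *ᵢ shift 0ᵢ (addExp e e') F t) p
                                    ≡ ∑ (λ (c , e) → (c' *ᵢ c) *ᵢ shift 0ᵢ (addExp e' e) F t) p
  swap (c' , e') =
    ∑-cong (λ (c , e) → cong₂ (λ a b → a *ᵢ shift 0ᵢ b F t) (ℤ[i].*-comm c c') (addExp-comm e e')) p

iter : Polyᵢ → ℕ → Series → Series
iter p zero    F = F
iter p (suc k) F = p ⋆ iter p k F

iter-cong : ∀ p k {F G} → F ≗ G → iter p k F ≗ iter p k G
iter-cong p zero    F≗G = F≗G
iter-cong p (suc k) F≗G = ⋆-cong p (iter-cong p k F≗G)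

⋆-iter : ∀ q p k F → q ⋆ iter p k F ≗ iter p k (q ⋆ F)
⋆-iter q p zero    F t = refl
⋆-iter q p (suc k) F t = trans (⋆-comm q p (iter p k F) t) (⋆-cong p (⋆-iter q p k F) t)

⟦_⟧ : Poly → Polyᵢ
⟦ p ⟧ = map (λ (c , e) → ι c , e) p

⟦⟧-⊕ : ∀ p q F t → (⟦ p ⊕ q ⟧ ⋆ F) t ≡ (⟦ p ⟧ ⋆ F) t +ᵢ (⟦ q ⟧ ⋆ F) t
⟦⟧-⊕ p q F t = trans (cong (λ r → (r ⋆ F) t) (map-++ _ p q)) (⋆-++ ⟦ p ⟧ ⟦ q ⟧ F t)

⟦⟧-⊖ : ∀ p F t → (⟦ ⊖ p ⟧ ⋆ F) t ≡ -ᵢ (⟦ p ⟧ ⋆ F) t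
⟦⟧-⊖ p F t = begin
  (⟦ ⊖ p ⟧ ⋆ F) t                                ≡⟨ trans (∑-map _ _ (map _ p)) (∑-map _ _ p) ⟩
  ∑ (λ (c , e) → ι (- c) *ᵢ shift 0ᵢ e F t) p    ≡⟨ ∑-cong (λ (c , e) → sym (ℤ[i].-‿distribˡ-* (ι c) _)) p ⟩
  ∑ (λ (c , e) → -ᵢ (ι c *ᵢ shift 0ᵢ e F t)) p   ≡⟨ ∑-neg _ p ⟩
  -ᵢ ∑ (λ (c , e) → ι c *ᵢ shift 0ᵢ e F t) p     ≡⟨ cong -ᵢ_ (∑-map _ _ p) ⟨
  -ᵢ (⟦ p ⟧ ⋆ F) t                               ∎
  where open ≡-Reasoning

⟦⟧-⊗ : ∀ p q F → ⟦ p ⊗ q ⟧ ⋆ F ≗ ⟦ p ⟧ ⋆ ⟦ q ⟧ ⋆ F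
⟦⟧-⊗ p q F t = begin
  (⟦ p ⊗ q ⟧ ⋆ F) t
    ≡⟨ trans (∑-map _ _ (p ⊗ q)) (∑-concatMap _ _ p) ⟩
  ∑ (λ (c , e) → ∑ (λ (c'' , e'') → ι c'' *ᵢ shift 0ᵢ e'' F t)
                   (map (λ (c' , e') → c ℤ.* c' , addExp e e') q)) p
    ≡⟨ ∑-cong (λ (c , e) → trans (∑-map _ _ q)
                                 (∑-cong (λ (c' , e') → cong (_*ᵢ shift 0ᵢ (addExp e e') F t) (ι-* c c')) q)) p ⟩
  ∑ (λ (c , e) → ∑ (λ (c' , e') → (ι c *ᵢ ι c') *ᵢ shift 0ᵢ (addExp e e') F t) q) p
    ≡⟨ trans (∑-map _ _ p) (∑-cong (λ (c , e) → ∑-map _ _ q) p) ⟨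
  ∑ (λ (c , e) → ∑ (λ (c' , e') → (c *ᵢ c') *ᵢ shift 0ᵢ (addExp e e') F t) ⟦ q ⟧) ⟦ p ⟧
    ≡⟨ ⋆-⋆ ⟦ p ⟧ ⟦ q ⟧ F t ⟨
  (⟦ p ⟧ ⋆ ⟦ q ⟧ ⋆ F) t ∎
  where open ≡-Reasoning

⟦onePoly⟧ : ∀ F → ⟦ onePoly ⟧ ⋆ F ≗ F
⟦onePoly⟧ F t = trans (ℤ[i].+-identityʳ _) (ℤ[i].*-identityˡ (F t))

⟦^ₚ⟧ : ∀ p k F → ⟦ p ^ₚ k ⟧ ⋆ F ≗ iter ⟦ p ⟧ k F
⟦^ₚ⟧ p zero    F t = ⟦onePoly⟧ F t
⟦^ₚ⟧ p (suc k) F t = trans (⟦⟧-⊗ p (p ^ₚ k) F t) (⋆-cong ⟦ p ⟧ (⟦^ₚ⟧ p k F) t)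

quad₀₂ : Poly
quad₀₂ = ((X ⊕ Z) ⊗ (X ⊕ Z)) ⊝ ((Y ⊕ W) ⊗ (Y ⊕ W))

quad₁₃ : Poly
quad₁₃ = ((X ⊝ Z) ⊗ (X ⊝ Z)) ⊕ ((Y ⊝ W) ⊗ (Y ⊝ W))

⟦eigenPoly⟧ : ∀ r s F → ⟦ eigenPoly r s ⟧ ⋆ F ≗ iter ⟦ quad₀₂ ⟧ r (iter ⟦ quad₁₃ ⟧ s F)
⟦eigenPoly⟧ r s F t = begin
  (⟦ eigenPoly r s ⟧ ⋆ F) t                    ≡⟨ ⟦⟧-⊗ (quad₀₂ ^ₚ r) (quad₁₃ ^ₚ s) F t ⟩
  (⟦ quad₀₂ ^ₚ r ⟧ ⋆ ⟦ quad₁₃ ^ₚ s ⟧ ⋆ F) t    ≡⟨ ⟦^ₚ⟧ quad₀₂ r _ t ⟩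
  iter ⟦ quad₀₂ ⟧ r (⟦ quad₁₃ ^ₚ s ⟧ ⋆ F) t    ≡⟨ iter-cong ⟦ quad₀₂ ⟧ r (⟦^ₚ⟧ quad₁₃ s F) t ⟩
  iter ⟦ quad₀₂ ⟧ r (iter ⟦ quad₁₃ ⟧ s F) t    ∎
  where open ≡-Reasoning

1ₛ : Series
1ₛ t = 𝟙 (ℕ⁴-eqᵇ (0 , 0 , 0 , 0) t)

shift-1ₛ : ∀ e t → shift 0ᵢ e 1ₛ t ≡ 𝟙 (ℕ⁴-eqᵇ e t)
shift-1ₛ e t = begin
  shift 0ᵢ e 1ₛ t
    ≡⟨ shift-natural 𝟙 false e (ℕ⁴-eqᵇ (0 , 0 , 0 , 0)) t ⟨
  𝟙 (maybe′ (ℕ⁴-eqᵇ (0 , 0 , 0 , 0)) false (t ∸⁴? e))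
    ≡⟨ cong 𝟙 (ℕ⁴-eqᵇ-addExp e _ t) ⟨
  𝟙 (ℕ⁴-eqᵇ (addExp e (0 , 0 , 0 , 0)) t)
    ≡⟨ cong (λ e' → 𝟙 (ℕ⁴-eqᵇ e' t)) (addExp-identityʳ e) ⟩
  𝟙 (ℕ⁴-eqᵇ e t) ∎
  where open ≡-Reasoning

coeff-⋆ : ∀ p t → ι (coeff p t) ≡ (⟦ p ⟧ ⋆ 1ₛ) t
coeff-⋆ p t = begin
  ι (coeff p t)                                        ≡⟨ ι-∑ proj₁ (filterᵇ _ p) ⟩
  ∑ (ι ∘ proj₁) (filterᵇ (λ (c , e) → ℕ⁴-eqᵇ e t) p)   ≡⟨ ∑-filterᵇ _ _ p ⟩
  ∑ (λ (c , e) → 𝟙 (ℕ⁴-eqᵇ e t) *ᵢ ι c) p              ≡⟨ ∑-cong (λ (c , e) → ℤ[i].*-comm _ (ι c)) p ⟩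
  ∑ (λ (c , e) → ι c *ᵢ 𝟙 (ℕ⁴-eqᵇ e t)) p              ≡⟨ ∑-cong (λ (c , e) → cong (ι c *ᵢ_) (shift-1ₛ e t)) p ⟨
  ∑ (λ (c , e) → ι c *ᵢ shift 0ᵢ e 1ₛ t) p             ≡⟨ ∑-map _ _ p ⟨
  (⟦ p ⟧ ⋆ 1ₛ) t                                       ∎
  where open ≡-Reasoning

-- The linear forms and their pair products

scale : ℤ[i] → Polyᵢ → Polyᵢ
scale α = map (λ (c , e) → α *ᵢ c , e)

scale-⋆ : ∀ α q F t → (scale α q ⋆ F) t ≡ α *ᵢ (q ⋆ F) t
scale-⋆ α q F t = begin
  (scale α q ⋆ F) t                                 ≡⟨ ∑-map _ _ q ⟩
  ∑ (λ (c , e) → (α *ᵢ c) *ᵢ shift 0ᵢ e F t) q      ≡⟨ ∑-cong (λ (c , e) → ℤ[i].*-assoc α c _) q ⟩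
  ∑ (λ (c , e) → α *ᵢ (c *ᵢ shift 0ᵢ e F t)) q      ≡⟨ ∑-*ˡ α _ q ⟩
  α *ᵢ (q ⋆ F) t                                    ∎
  where open ≡-Reasoning

-- (p + α q)(p − α q) = p² − α² q², which only needs p and q to commute
⋆-difference-of-squares : ∀ p q α F t →
  ((p ++ scale α q) ⋆ (p ++ scale (-ᵢ α) q) ⋆ F) t ≡ (p ⋆ p ⋆ F) t +ᵢ -ᵢ ((α *ᵢ α) *ᵢ (q ⋆ q ⋆ F) t)
⋆-difference-of-squares p q α F t = begin
  ((p ++ scale α q) ⋆ G) t
    ≡⟨ trans (⋆-++ p _ G t) (cong ((p ⋆ G) t +ᵢ_) (scale-⋆ α q G t)) ⟩
  (p ⋆ G) t +ᵢ α *ᵢ (q ⋆ G) t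
    ≡⟨ cong₂ (λ u v → u +ᵢ α *ᵢ v) (expand p) (expand q) ⟩
  ((p ⋆ p ⋆ F) t +ᵢ -ᵢ α *ᵢ (p ⋆ q ⋆ F) t) +ᵢ α *ᵢ ((q ⋆ p ⋆ F) t +ᵢ -ᵢ α *ᵢ (q ⋆ q ⋆ F) t)
    ≡⟨ cong (λ u → ((p ⋆ p ⋆ F) t +ᵢ -ᵢ α *ᵢ u) +ᵢ α *ᵢ ((q ⋆ p ⋆ F) t +ᵢ -ᵢ α *ᵢ (q ⋆ q ⋆ F) t))
            (⋆-comm p q F t) ⟩
  ((p ⋆ p ⋆ F) t +ᵢ -ᵢ α *ᵢ (q ⋆ p ⋆ F) t) +ᵢ α *ᵢ ((q ⋆ p ⋆ F) t +ᵢ -ᵢ α *ᵢ (q ⋆ q ⋆ F) t)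
    ≡⟨ cancel ((p ⋆ p ⋆ F) t) ((q ⋆ p ⋆ F) t) ((q ⋆ q ⋆ F) t) α ⟩
  (p ⋆ p ⋆ F) t +ᵢ -ᵢ ((α *ᵢ α) *ᵢ (q ⋆ q ⋆ F) t) ∎
  where
  open ≡-Reasoning
  G : Series
  G = (p ++ scale (-ᵢ α) q) ⋆ F
  G≗ : G ≗ λ u → (p ⋆ F) u +ᵢ -ᵢ α *ᵢ (q ⋆ F) u
  G≗ u = trans (⋆-++ p _ F u) (cong ((p ⋆ F) u +ᵢ_) (scale-⋆ (-ᵢ α) q F u))
  expand : ∀ r → (r ⋆ G) t ≡ (r ⋆ p ⋆ F) t +ᵢ -ᵢ α *ᵢ (r ⋆ q ⋆ F) t
  expand r = trans (⋆-cong r G≗ t) (trans (⋆-+ r _ _ t) (cong ((r ⋆ p ⋆ F) t +ᵢ_) (⋆-*ˡ r (-ᵢ α) (q ⋆ F) t)))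
  cancel : ∀ a b c α → (a +ᵢ -ᵢ α *ᵢ b) +ᵢ α *ᵢ (b +ᵢ -ᵢ α *ᵢ c) ≡ a +ᵢ -ᵢ ((α *ᵢ α) *ᵢ c)
  cancel = RingSolver.solve-∀ ℤ[i]-ring

δ : ℤ₄ → ℕ⁴
δ 0F = (1 , 0 , 0 , 0)
δ 1F = (0 , 1 , 0 , 0)
δ 2F = (0 , 0 , 1 , 0)
δ 3F = (0 , 0 , 0 , 1)

ζ : ℕ → ℤ[i]
ζ k = ζ₄^ (mod4 k)

ζ-suc : ∀ k → ζ (suc k) ≡ i *ᵢ ζ k
ζ-suc 0 = refl
ζ-suc 1 = refl
ζ-suc 2 = refl
ζ-suc 3 = refl
ζ-suc (suc (suc (suc (suc k)))) = ζ-suc k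

ζ-+ : ∀ m n → ζ (m + n) ≡ ζ m *ᵢ ζ n
ζ-+ zero    n = sym (ℤ[i].*-identityˡ (ζ n))
ζ-+ (suc m) n = begin
  ζ (suc (m + n))      ≡⟨ ζ-suc (m + n) ⟩
  i *ᵢ ζ (m + n)       ≡⟨ cong (i *ᵢ_) (ζ-+ m n) ⟩
  i *ᵢ (ζ m *ᵢ ζ n)    ≡⟨ ℤ[i].*-assoc i (ζ m) (ζ n) ⟨
  (i *ᵢ ζ m) *ᵢ ζ n    ≡⟨ cong (_*ᵢ ζ n) (ζ-suc m) ⟨
  ζ (suc m) *ᵢ ζ n     ∎
  where open ≡-Reasoning

linearForm : ℤ₄ → Polyᵢ
linearForm a = map (λ c → ζ (toℕ c * toℕ a) , δ c) (allFin 4)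

binomial : ℤ[i] → ℕ⁴ → ℕ⁴ → Polyᵢ
binomial β e e' = (1ᵢ , e) ∷ (β , e') ∷ []

reorder-linearForm : ∀ α β (G : Series) t → let s = λ c → shift 0ᵢ (δ c) G t in
  1ᵢ *ᵢ s 0F +ᵢ (α *ᵢ s 1F +ᵢ (β *ᵢ s 2F +ᵢ ((α *ᵢ β) *ᵢ s 3F +ᵢ 0ᵢ)))
  ≡ 1ᵢ *ᵢ s 0F +ᵢ (β *ᵢ s 2F +ᵢ ((α *ᵢ 1ᵢ) *ᵢ s 1F +ᵢ ((α *ᵢ β) *ᵢ s 3F +ᵢ 0ᵢ)))
reorder-linearForm α β G t = reorder α β (s 0F) (s 1F) (s 2F) (s 3F)
  where
  reorder : ∀ α β x y z w → 1ᵢ *ᵢ x +ᵢ (α *ᵢ y +ᵢ (β *ᵢ z +ᵢ ((α *ᵢ β) *ᵢ w +ᵢ 0ᵢ)))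
                          ≡ 1ᵢ *ᵢ x +ᵢ (β *ᵢ z +ᵢ ((α *ᵢ 1ᵢ) *ᵢ y +ᵢ ((α *ᵢ β) *ᵢ w +ᵢ 0ᵢ)))
  reorder = RingSolver.solve-∀ ℤ[i]-ring
  s : ℤ₄ → ℤ[i]
  s c = shift 0ᵢ (δ c) G t

linearForm-split : ∀ a G → let β = ζ (2 * toℕ a) in
  linearForm a ⋆ G ≗ (binomial β (δ 0F) (δ 2F) ++ scale (ζ (toℕ a)) (binomial β (δ 1F) (δ 3F))) ⋆ G
linearForm-split 0F G t = reorder-linearForm (ζ 0) (ζ 0) G t
linearForm-split 1F G t = reorder-linearForm (ζ 1) (ζ 2) G t
linearForm-split 2F G t = reorder-linearForm (ζ 2) (ζ 0) G t
linearForm-split 3F G t = reorder-linearForm (ζ 3) (ζ 2) G t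

linearForm-pair₀₂ : ∀ F → linearForm 0F ⋆ linearForm 2F ⋆ F ≗ ⟦ quad₀₂ ⟧ ⋆ F
linearForm-pair₀₂ F t = begin
  (linearForm 0F ⋆ linearForm 2F ⋆ F) t
    ≡⟨ ⋆-cong (linearForm 0F) (linearForm-split 2F F) t ⟩
  (linearForm 0F ⋆ (p ++ scale (-ᵢ 1ᵢ) q) ⋆ F) t
    ≡⟨ linearForm-split 0F _ t ⟩
  ((p ++ scale 1ᵢ q) ⋆ (p ++ scale (-ᵢ 1ᵢ) q) ⋆ F) t
    ≡⟨ ⋆-difference-of-squares p q 1ᵢ F t ⟩
  (p ⋆ p ⋆ F) t +ᵢ -ᵢ ((1ᵢ *ᵢ 1ᵢ) *ᵢ (q ⋆ q ⋆ F) t)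
    ≡⟨ cong (λ u → (p ⋆ p ⋆ F) t +ᵢ -ᵢ u) (ℤ[i].*-identityˡ _) ⟩
  (p ⋆ p ⋆ F) t +ᵢ -ᵢ (q ⋆ q ⋆ F) t
    ≡⟨ cong₂ (λ u v → u +ᵢ -ᵢ v) (⟦⟧-⊗ (X ⊕ Z) (X ⊕ Z) F t) (⟦⟧-⊗ (Y ⊕ W) (Y ⊕ W) F t) ⟨
  (⟦ (X ⊕ Z) ⊗ (X ⊕ Z) ⟧ ⋆ F) t +ᵢ -ᵢ (⟦ (Y ⊕ W) ⊗ (Y ⊕ W) ⟧ ⋆ F) t
    ≡⟨ cong ((⟦ (X ⊕ Z) ⊗ (X ⊕ Z) ⟧ ⋆ F) t +ᵢ_) (⟦⟧-⊖ ((Y ⊕ W) ⊗ (Y ⊕ W)) F t) ⟨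
  (⟦ (X ⊕ Z) ⊗ (X ⊕ Z) ⟧ ⋆ F) t +ᵢ (⟦ ⊖ ((Y ⊕ W) ⊗ (Y ⊕ W)) ⟧ ⋆ F) t
    ≡⟨ ⟦⟧-⊕ ((X ⊕ Z) ⊗ (X ⊕ Z)) (⊖ ((Y ⊕ W) ⊗ (Y ⊕ W))) F t ⟨
  (⟦ quad₀₂ ⟧ ⋆ F) t ∎
  where
  open ≡-Reasoning
  p q : Polyᵢ
  p = binomial 1ᵢ (δ 0F) (δ 2F)
  q = binomial 1ᵢ (δ 1F) (δ 3F)

linearForm-pair₁₃ : ∀ F → linearForm 1F ⋆ linearForm 3F ⋆ F ≗ ⟦ quad₁₃ ⟧ ⋆ F
linearForm-pair₁₃ F t = begin
  (linearForm 1F ⋆ linearForm 3F ⋆ F) t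
    ≡⟨ ⋆-cong (linearForm 1F) (linearForm-split 3F F) t ⟩
  (linearForm 1F ⋆ (p ++ scale (-ᵢ i) q) ⋆ F) t
    ≡⟨ linearForm-split 1F _ t ⟩
  ((p ++ scale i q) ⋆ (p ++ scale (-ᵢ i) q) ⋆ F) t
    ≡⟨ ⋆-difference-of-squares p q i F t ⟩
  (p ⋆ p ⋆ F) t +ᵢ -ᵢ ((i *ᵢ i) *ᵢ (q ⋆ q ⋆ F) t)
    ≡⟨ cong ((p ⋆ p ⋆ F) t +ᵢ_) (i²-neg ((q ⋆ q ⋆ F) t)) ⟩
  (p ⋆ p ⋆ F) t +ᵢ (q ⋆ q ⋆ F) t
    ≡⟨ cong₂ _+ᵢ_ (⟦⟧-⊗ (X ⊝ Z) (X ⊝ Z) F t) (⟦⟧-⊗ (Y ⊝ W) (Y ⊝ W) F t) ⟨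
  (⟦ (X ⊝ Z) ⊗ (X ⊝ Z) ⟧ ⋆ F) t +ᵢ (⟦ (Y ⊝ W) ⊗ (Y ⊝ W) ⟧ ⋆ F) t
    ≡⟨ ⟦⟧-⊕ ((X ⊝ Z) ⊗ (X ⊝ Z)) ((Y ⊝ W) ⊗ (Y ⊝ W)) F t ⟨
  (⟦ quad₁₃ ⟧ ⋆ F) t ∎
  where
  open ≡-Reasoning
  p q : Polyᵢ
  p = binomial (ζ 2) (δ 0F) (δ 2F)
  q = binomial (ζ 2) (δ 1F) (δ 3F)
  i²-neg : ∀ x → -ᵢ ((i *ᵢ i) *ᵢ x) ≡ x
  i²-neg = RingSolver.solve-∀ ℤ[i]-ring

-- Character series

_·ℕ_ : ∀ {n} → Vec ℤ₄ n → Vec ℤ₄ n → ℕ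
b ·ℕ v = Vec.sum (Vec.zipWith (λ x y → toℕ x * toℕ y) b v)

ofType : ∀ {n} → ℕ⁴ → Vec ℤ₄ n → Bool
ofType e b = ℕ⁴-eqᵇ (typeOf b) e

𝒦 : ∀ {n} → Vec ℤ₄ n → Series
𝒦 {n} v e = ∑ (λ b → 𝟙 (ofType e b) *ᵢ ζ (b ·ℕ v)) (allVecs n)

eigenvalue≡𝒦 : ∀ n r s (v : Vec ℤ₄ n) → eigenvalue n r s v ≡ 𝒦 v (r , s , r , s)
eigenvalue≡𝒦 n r s v = ∑-filterᵇ _ _ (allVecs n)

𝒦-[] : 𝒦 [] ≗ 1ₛ
𝒦-[] e = trans (ℤ[i].+-identityʳ _) (ℤ[i].*-identityʳ _)

typeOf-∷ : ∀ {n} c (b : Vec ℤ₄ n) → typeOf (c ∷ b) ≡ addExp (δ c) (typeOf b)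
typeOf-∷ 0F b = refl
typeOf-∷ 1F b = refl
typeOf-∷ 2F b = refl
typeOf-∷ 3F b = refl

ofType-∷ : ∀ {n} c (b : Vec ℤ₄ n) e → ofType e (c ∷ b) ≡ shift false (δ c) (λ e' → ofType e' b) e
ofType-∷ c b e = trans (cong (λ t → ℕ⁴-eqᵇ t e) (typeOf-∷ c b)) (ℕ⁴-eqᵇ-addExp (δ c) (typeOf b) e)

𝒦-∷ : ∀ {n} a (v : Vec ℤ₄ n) → 𝒦 (a ∷ v) ≗ linearForm a ⋆ 𝒦 v
𝒦-∷ {n} a v e = begin
  𝒦 (a ∷ v) e
    ≡⟨ ∑-concatMap summand (λ c → map (c ∷_) (allVecs n)) (allFin 4) ⟩
  ∑ (λ c → ∑ summand (map (c ∷_) (allVecs n))) (allFin 4)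
    ≡⟨ ∑-cong (λ c → trans (∑-map summand (c ∷_) (allVecs n)) (first-letter c)) (allFin 4) ⟩
  ∑ (λ c → ζ (toℕ c * toℕ a) *ᵢ shift 0ᵢ (δ c) (𝒦 v) e) (allFin 4)
    ≡⟨ ∑-map (λ (z , d) → z *ᵢ shift 0ᵢ d (𝒦 v) e) (λ c → ζ (toℕ c * toℕ a) , δ c) (allFin 4) ⟨
  (linearForm a ⋆ 𝒦 v) e ∎
  where
  open ≡-Reasoning
  summand : Vec ℤ₄ (suc n) → ℤ[i]
  summand b = 𝟙 (ofType e b) *ᵢ ζ (b ·ℕ (a ∷ v))
  first-letter : ∀ c → ∑ (λ b → 𝟙 (ofType e (c ∷ b)) *ᵢ ζ (toℕ c * toℕ a + b ·ℕ v)) (allVecs n)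
                     ≡ ζ (toℕ c * toℕ a) *ᵢ shift 0ᵢ (δ c) (𝒦 v) e
  first-letter c = begin
    ∑ (λ b → 𝟙 (ofType e (c ∷ b)) *ᵢ ζ (k + b ·ℕ v)) (allVecs n)
      ≡⟨ ∑-cong term (allVecs n) ⟩
    ∑ (λ b → ζ k *ᵢ shift 0ᵢ (δ c) (λ e' → 𝟙 (ofType e' b) *ᵢ ζ (b ·ℕ v)) e) (allVecs n)
      ≡⟨ ∑-*ˡ (ζ k) _ (allVecs n) ⟩
    ζ k *ᵢ ∑ (λ b → shift 0ᵢ (δ c) (λ e' → 𝟙 (ofType e' b) *ᵢ ζ (b ·ℕ v)) e) (allVecs n)
      ≡⟨ cong (ζ k *ᵢ_) (shift-∑ (δ c) (λ b e' → 𝟙 (ofType e' b) *ᵢ ζ (b ·ℕ v)) (allVecs n) e) ⟨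
    ζ k *ᵢ shift 0ᵢ (δ c) (𝒦 v) e ∎
    where
    k : ℕ
    k = toℕ c * toℕ a
    term : ∀ b → 𝟙 (ofType e (c ∷ b)) *ᵢ ζ (k + b ·ℕ v)
               ≡ ζ k *ᵢ shift 0ᵢ (δ c) (λ e' → 𝟙 (ofType e' b) *ᵢ ζ (b ·ℕ v)) e
    term b = begin
      𝟙 (ofType e (c ∷ b)) *ᵢ ζ (k + b ·ℕ v)
        ≡⟨ cong₂ (λ β z → 𝟙 β *ᵢ z) (ofType-∷ c b e) (ζ-+ k (b ·ℕ v)) ⟩
      𝟙 (shift false (δ c) (λ e' → ofType e' b) e) *ᵢ (ζ k *ᵢ ζ (b ·ℕ v))
        ≡⟨ ℤ[i].x∙yz≈y∙xz (𝟙 (shift false (δ c) (λ e' → ofType e' b) e)) (ζ k) (ζ (b ·ℕ v)) ⟩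
      ζ k *ᵢ (𝟙 (shift false (δ c) (λ e' → ofType e' b) e) *ᵢ ζ (b ·ℕ v))
        ≡⟨ cong (ζ k *ᵢ_) (shift-𝟙 (δ c) (λ e' → ofType e' b) (ζ (b ·ℕ v)) e) ⟨
      ζ k *ᵢ shift 0ᵢ (δ c) (λ e' → 𝟙 (ofType e' b) *ᵢ ζ (b ·ℕ v)) e ∎

𝒦ᵗ : ℕ⁴ → Series
𝒦ᵗ (t₀ , t₁ , t₂ , t₃) =
  iter (linearForm 0F) t₀ (iter (linearForm 1F) t₁ (iter (linearForm 2F) t₂ (iter (linearForm 3F) t₃ 1ₛ)))

linearForm-𝒦ᵗ : ∀ a t → linearForm a ⋆ 𝒦ᵗ t ≗ 𝒦ᵗ (addExp (δ a) t)
linearForm-𝒦ᵗ 0F (t₀ , t₁ , t₂ , t₃) e = refl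
linearForm-𝒦ᵗ 1F (t₀ , t₁ , t₂ , t₃) e = ⋆-iter (linearForm 1F) (linearForm 0F) t₀ _ e
linearForm-𝒦ᵗ 2F (t₀ , t₁ , t₂ , t₃) e =
  trans (⋆-iter (linearForm 2F) (linearForm 0F) t₀ _ e)
        (iter-cong (linearForm 0F) t₀ (⋆-iter (linearForm 2F) (linearForm 1F) t₁ _) e)
linearForm-𝒦ᵗ 3F (t₀ , t₁ , t₂ , t₃) e =
  trans (⋆-iter (linearForm 3F) (linearForm 0F) t₀ _ e)
        (iter-cong (linearForm 0F) t₀
          (λ e' → trans (⋆-iter (linearForm 3F) (linearForm 1F) t₁ _ e')
                        (iter-cong (linearForm 1F) t₁ (⋆-iter (linearForm 3F) (linearForm 2F) t₂ _) e')) e)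

𝒦≗𝒦ᵗ-typeOf : ∀ {n} (v : Vec ℤ₄ n) → 𝒦 v ≗ 𝒦ᵗ (typeOf v)
𝒦≗𝒦ᵗ-typeOf []      e = 𝒦-[] e
𝒦≗𝒦ᵗ-typeOf (a ∷ v) e = begin
  𝒦 (a ∷ v) e                         ≡⟨ 𝒦-∷ a v e ⟩
  (linearForm a ⋆ 𝒦 v) e              ≡⟨ ⋆-cong (linearForm a) (𝒦≗𝒦ᵗ-typeOf v) e ⟩
  (linearForm a ⋆ 𝒦ᵗ (typeOf v)) e    ≡⟨ linearForm-𝒦ᵗ a (typeOf v) e ⟩
  𝒦ᵗ (addExp (δ a) (typeOf v)) e      ≡⟨ cong (λ t → 𝒦ᵗ t e) (typeOf-∷ a v) ⟨
  𝒦ᵗ (typeOf (a ∷ v)) e               ∎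
  where open ≡-Reasoning

pairedWord : ℕ → ℕ → List ℤ₄
pairedWord zero    zero    = []
pairedWord zero    (suc s) = 1F ∷ 3F ∷ pairedWord zero s
pairedWord (suc r) s       = 0F ∷ 2F ∷ pairedWord r s

typeOf-pairedWord : ∀ r s → typeOf (Vec.fromList (pairedWord r s)) ≡ (r , s , r , s)
typeOf-pairedWord zero    zero    = refl
typeOf-pairedWord zero    (suc s) = cong (λ t → addExp (δ 1F) (addExp (δ 3F) t)) (typeOf-pairedWord zero s)
typeOf-pairedWord (suc r) s       = cong (λ t → addExp (δ 0F) (addExp (δ 2F) t)) (typeOf-pairedWord r s)

𝒦-pairedWord : ∀ r s → 𝒦 (Vec.fromList (pairedWord r s)) ≗ iter ⟦ quad₀₂ ⟧ r (iter ⟦ quad₁₃ ⟧ s 1ₛ)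
𝒦-pairedWord zero zero = 𝒦-[]
𝒦-pairedWord zero (suc s) t = begin
  𝒦 (1F ∷ 3F ∷ v) t
    ≡⟨ trans (𝒦-∷ 1F (3F ∷ v) t) (⋆-cong (linearForm 1F) (𝒦-∷ 3F v) t) ⟩
  (linearForm 1F ⋆ linearForm 3F ⋆ 𝒦 v) t
    ≡⟨ linearForm-pair₁₃ (𝒦 v) t ⟩
  (⟦ quad₁₃ ⟧ ⋆ 𝒦 v) t
    ≡⟨ ⋆-cong ⟦ quad₁₃ ⟧ (𝒦-pairedWord zero s) t ⟩
  iter ⟦ quad₁₃ ⟧ (suc s) 1ₛ t ∎
  where
  open ≡-Reasoning
  v : Vec ℤ₄ (List.length (pairedWord zero s))
  v = Vec.fromList (pairedWord zero s)
𝒦-pairedWord (suc r) s t = begin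
  𝒦 (0F ∷ 2F ∷ v) t
    ≡⟨ trans (𝒦-∷ 0F (2F ∷ v) t) (⋆-cong (linearForm 0F) (𝒦-∷ 2F v) t) ⟩
  (linearForm 0F ⋆ linearForm 2F ⋆ 𝒦 v) t
    ≡⟨ linearForm-pair₀₂ (𝒦 v) t ⟩
  (⟦ quad₀₂ ⟧ ⋆ 𝒦 v) t
    ≡⟨ ⋆-cong ⟦ quad₀₂ ⟧ (𝒦-pairedWord r s) t ⟩
  iter ⟦ quad₀₂ ⟧ (suc r) (iter ⟦ quad₁₃ ⟧ s 1ₛ) t ∎
  where
  open ≡-Reasoning
  v : Vec ℤ₄ (List.length (pairedWord r s))
  v = Vec.fromList (pairedWord r s)

𝒦ᵗ-coeff : ∀ r s t → 𝒦ᵗ (r , s , r , s) t ≡ ι (coeff (eigenPoly r s) t)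
𝒦ᵗ-coeff r s t = begin
  𝒦ᵗ (r , s , r , s) t                                   ≡⟨ cong (λ e → 𝒦ᵗ e t) (typeOf-pairedWord r s) ⟨
  𝒦ᵗ (typeOf (Vec.fromList (pairedWord r s))) t          ≡⟨ 𝒦≗𝒦ᵗ-typeOf (Vec.fromList (pairedWord r s)) t ⟨
  𝒦 (Vec.fromList (pairedWord r s)) t                    ≡⟨ 𝒦-pairedWord r s t ⟩
  iter ⟦ quad₀₂ ⟧ r (iter ⟦ quad₁₃ ⟧ s 1ₛ) t             ≡⟨ ⟦eigenPoly⟧ r s 1ₛ t ⟨
  (⟦ eigenPoly r s ⟧ ⋆ 1ₛ) t                             ≡⟨ coeff-⋆ (eigenPoly r s) t ⟨
  ι (coeff (eigenPoly r s) t)                            ∎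
  where open ≡-Reasoning

-- Counting vectors of a given type

#ofType : ℕ → ℕ⁴ → ℤ[i]
#ofType n t = ∑ (λ v → 𝟙 (ofType t v)) (allVecs n)

·ℕ-replicate-0 : ∀ {n} (v : Vec ℤ₄ n) → v ·ℕ Vec.replicate n 0F ≡ 0
·ℕ-replicate-0 []      = refl
·ℕ-replicate-0 (x ∷ v) = cong₂ _+_ (ℕ.*-zeroʳ (toℕ x)) (·ℕ-replicate-0 v)

#ofType≡𝒦-replicate : ∀ n t → #ofType n t ≡ 𝒦 (Vec.replicate n 0F) t
#ofType≡𝒦-replicate n t =
  ∑-cong (λ v → sym (trans (cong (λ k → 𝟙 (ofType t v) *ᵢ ζ k) (·ℕ-replicate-0 v)) (ℤ[i].*-identityʳ _)))
         (allVecs n)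

𝒦-replicate : ∀ n → 𝒦 (Vec.replicate n 0F) ≗ iter (linearForm 0F) n 1ₛ
𝒦-replicate zero    = 𝒦-[]
𝒦-replicate (suc n) t = trans (𝒦-∷ 0F (Vec.replicate n 0F) t) (⋆-cong (linearForm 0F) (𝒦-replicate n) t)

multinomialRec : ℕ → ℕ⁴ → ℕ
multinomialRec zero    t = if ℕ⁴-eqᵇ (0 , 0 , 0 , 0) t then 1 else 0
multinomialRec (suc n) t = sum (map (λ c → shift 0 (δ c) (multinomialRec n) t) (allFin 4))

iter-linearForm₀-1ₛ : ∀ n t → iter (linearForm 0F) n 1ₛ t ≡ ι (+ multinomialRec n t)
iter-linearForm₀-1ₛ zero t with ℕ⁴-eqᵇ (0 , 0 , 0 , 0) t
... | true  = refl
... | false = refl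
iter-linearForm₀-1ₛ (suc n) t = begin
  (linearForm 0F ⋆ iter (linearForm 0F) n 1ₛ) t
    ≡⟨ ∑-map (λ (z , e) → z *ᵢ shift 0ᵢ e G t) (λ c → ζ (toℕ c * 0) , δ c) (allFin 4) ⟩
  ∑ (λ c → ζ (toℕ c * 0) *ᵢ shift 0ᵢ (δ c) G t) (allFin 4)
    ≡⟨ ∑-cong term (allFin 4) ⟩
  ∑ (λ c → ι (+ shift 0 (δ c) (multinomialRec n) t)) (allFin 4)
    ≡⟨ ι+-sum (λ c → shift 0 (δ c) (multinomialRec n) t) (allFin 4) ⟨
  ι (+ multinomialRec (suc n) t) ∎
  where
  open ≡-Reasoning
  G : Series
  G = iter (linearForm 0F) n 1ₛ
  term : ∀ c → ζ (toℕ c * 0) *ᵢ shift 0ᵢ (δ c) G t ≡ ι (+ shift 0 (δ c) (multinomialRec n) t)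
  term c = begin
    ζ (toℕ c * 0) *ᵢ shift 0ᵢ (δ c) G t
      ≡⟨ cong (λ k → ζ k *ᵢ shift 0ᵢ (δ c) G t) (ℕ.*-zeroʳ (toℕ c)) ⟩
    1ᵢ *ᵢ shift 0ᵢ (δ c) G t
      ≡⟨ ℤ[i].*-identityˡ _ ⟩
    shift 0ᵢ (δ c) G t
      ≡⟨ shift-cong 0ᵢ (δ c) (iter-linearForm₀-1ₛ n) t ⟩
    shift 0ᵢ (δ c) (λ u → ι (+ multinomialRec n u)) t
      ≡⟨ shift-natural (λ k → ι (+ k)) 0 (δ c) (multinomialRec n) t ⟨
    ι (+ shift 0 (δ c) (multinomialRec n) t) ∎

coord : ℤ₄ → ℕ⁴ → ℕ
coord 0F (a , b , c , d) = a
coord 1F (a , b , c , d) = b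
coord 2F (a , b , c , d) = c
coord 3F (a , b , c , d) = d

sum4 : ℕ⁴ → ℕ
sum4 (a , b , c , d) = a + b + c + d

fact4 : ℕ⁴ → ℕ
fact4 (a , b , c , d) = a ! * b ! * c ! * d !

coord-addExp-δ : ∀ c u → coord c (addExp (δ c) u) ≡ suc (coord c u)
coord-addExp-δ 0F u = refl
coord-addExp-δ 1F u = refl
coord-addExp-δ 2F u = refl
coord-addExp-δ 3F u = refl

sum4-addExp-δ : ∀ c u → sum4 (addExp (δ c) u) ≡ suc (sum4 u)
sum4-addExp-δ 0F (a , b , c , d) = refl
sum4-addExp-δ 1F (a , b , c , d) = cong (λ x → x + c + d) (ℕ.+-suc a b)
sum4-addExp-δ 2F (a , b , c , d) = cong (_+ d) (ℕ.+-suc (a + b) c)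
sum4-addExp-δ 3F (a , b , c , d) = ℕ.+-suc (a + b + c) d

fact4-addExp-δ : ∀ c u → fact4 (addExp (δ c) u) ≡ suc (coord c u) * fact4 u
fact4-addExp-δ 0F (a , b , c , d) = at₀ (suc a) (a !) (b !) (c !) (d !)
  where
  at₀ : ∀ x a b c d → x * a * b * c * d ≡ x * (a * b * c * d)
  at₀ = ℕ-solve-∀
fact4-addExp-δ 1F (a , b , c , d) = at₁ (suc b) (a !) (b !) (c !) (d !)
  where
  at₁ : ∀ x a b c d → a * (x * b) * c * d ≡ x * (a * b * c * d)
  at₁ = ℕ-solve-∀
fact4-addExp-δ 2F (a , b , c , d) = at₂ (suc c) (a !) (b !) (c !) (d !)
  where
  at₂ : ∀ x a b c d → a * b * (x * c) * d ≡ x * (a * b * c * d)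
  at₂ = ℕ-solve-∀
fact4-addExp-δ 3F (a , b , c , d) = at₃ (suc d) (a !) (b !) (c !) (d !)
  where
  at₃ : ∀ x a b c d → a * b * c * (x * d) ≡ x * (a * b * c * d)
  at₃ = ℕ-solve-∀

multinomialRec-*-fact4 : ∀ n t → sum4 t ≡ n → multinomialRec n t * fact4 t ≡ n !
multinomialRec-*-fact4 zero (zero , zero , zero , zero) h = refl
multinomialRec-*-fact4 (suc n) t h = begin
  multinomialRec (suc n) t * fact4 t
    ≡⟨ distrib (term 0F) (term 1F) (term 2F) (term 3F) (fact4 t) ⟩
  term 0F * fact4 t + (term 1F * fact4 t + (term 2F * fact4 t + term 3F * fact4 t))
    ≡⟨ cong₂ _+_ (step 0F t h) (cong₂ _+_ (step 1F t h) (cong₂ _+_ (step 2F t h) (step 3F t h))) ⟩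
  coord 0F t * n ! + (coord 1F t * n ! + (coord 2F t * n ! + coord 3F t * n !))
    ≡⟨ collect (coord 0F t) (coord 1F t) (coord 2F t) (coord 3F t) (n !) ⟩
  sum4 t * n !
    ≡⟨ cong (_* n !) h ⟩
  suc n ! ∎
  where
  open ≡-Reasoning
  open CommutativeSemigroupProperties ℕ.*-commutativeSemigroup using (x∙yz≈y∙xz)
  term : ℤ₄ → ℕ
  term c = shift 0 (δ c) (multinomialRec n) t
  distrib : ∀ a b c d f → (a + (b + (c + (d + 0)))) * f ≡ a * f + (b * f + (c * f + d * f))
  distrib = ℕ-solve-∀
  collect : ∀ a b c d m → a * m + (b * m + (c * m + d * m)) ≡ (a + b + c + d) * m
  collect = ℕ-solve-∀
  above : ∀ c u → sum4 (addExp (δ c) u) ≡ suc n →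
          shift 0 (δ c) (multinomialRec n) (addExp (δ c) u) * fact4 (addExp (δ c) u)
          ≡ coord c (addExp (δ c) u) * n !
  above c u h = begin
    shift 0 (δ c) (multinomialRec n) (addExp (δ c) u) * fact4 (addExp (δ c) u)
      ≡⟨ cong₂ _*_ (shift-addExp 0 (δ c) (multinomialRec n) u) (fact4-addExp-δ c u) ⟩
    multinomialRec n u * (suc (coord c u) * fact4 u)
      ≡⟨ x∙yz≈y∙xz (multinomialRec n u) (suc (coord c u)) (fact4 u) ⟩
    suc (coord c u) * (multinomialRec n u * fact4 u)
      ≡⟨ cong (suc (coord c u) *_) (multinomialRec-*-fact4 n u (ℕ.suc-injective (trans (sym (sum4-addExp-δ c u)) h))) ⟩
    suc (coord c u) * n !
      ≡⟨ cong (_* n !) (coord-addExp-δ c u) ⟨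
    coord c (addExp (δ c) u) * n ! ∎
  step : ∀ c t → sum4 t ≡ suc n → shift 0 (δ c) (multinomialRec n) t * fact4 t ≡ coord c t * n !
  step 0F (zero  , t₁ , t₂ , t₃) h = refl
  step 0F (suc k , t₁ , t₂ , t₃) h = above 0F (k , t₁ , t₂ , t₃) h
  step 1F (t₀ , zero  , t₂ , t₃) h = refl
  step 1F (t₀ , suc k , t₂ , t₃) h = above 1F (t₀ , k , t₂ , t₃) h
  step 2F (t₀ , t₁ , zero  , t₃) h = refl
  step 2F (t₀ , t₁ , suc k , t₃) h = above 2F (t₀ , t₁ , k , t₃) h
  step 3F (t₀ , t₁ , t₂ , zero ) h = refl
  step 3F (t₀ , t₁ , t₂ , suc k) h = above 3F (t₀ , t₁ , t₂ , k) h

multinomial⁴ : ℕ⁴ → ℕ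
multinomial⁴ (a , b , c , d) = multinomial a b c d

fact4≢0 : ∀ t → ℕ.NonZero (fact4 t)
fact4≢0 (a , b , c , d) = ℕ.m*n≢0 (a ! * b ! * c !) (d !) {{abc≢0}} {{d !≢0}}
  where
  abc≢0 : ℕ.NonZero (a ! * b ! * c !)
  abc≢0 = ℕ.m*n≢0 (a ! * b !) (c !) {{ℕ.m*n≢0 (a !) (b !) {{a !≢0}} {{b !≢0}}}} {{c !≢0}}

multinomial≡multinomialRec : ∀ n t → sum4 t ≡ n → multinomial⁴ t ≡ multinomialRec n t
multinomial≡multinomialRec n t h = begin
  (sum4 t !) DivMod./ fact4 t
    ≡⟨ cong (λ k → k DivMod./ fact4 t) (trans (cong _! h) (sym (multinomialRec-*-fact4 n t h))) ⟩
  (multinomialRec n t * fact4 t) DivMod./ fact4 t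
    ≡⟨ m*n/n≡m (multinomialRec n t) (fact4 t) ⟩
  multinomialRec n t ∎
  where
  open ≡-Reasoning
  instance
    _ = fact4≢0 t

#ofType≡multinomial : ∀ n t → sum4 t ≡ n → #ofType n t ≡ ι (+ multinomial⁴ t)
#ofType≡multinomial n t h = begin
  #ofType n t                   ≡⟨ #ofType≡𝒦-replicate n t ⟩
  𝒦 (Vec.replicate n 0F) t      ≡⟨ 𝒦-replicate n t ⟩
  iter (linearForm 0F) n 1ₛ t   ≡⟨ iter-linearForm₀-1ₛ n t ⟩
  ι (+ multinomialRec n t)      ≡⟨ cong (λ k → ι (+ k)) (multinomial≡multinomialRec n t h) ⟨
  ι (+ multinomial⁴ t)          ∎
  where open ≡-Reasoning

sum4-typeOf : ∀ {n} (v : Vec ℤ₄ n) → sum4 (typeOf v) ≡ n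
sum4-typeOf []      = refl
sum4-typeOf (a ∷ v) = trans (cong sum4 (typeOf-∷ a v)) (trans (sum4-addExp-δ a (typeOf v)) (cong suc (sum4-typeOf v)))

multinomial≢0 : ∀ n t → sum4 t ≡ n → multinomial⁴ t ≢ 0
multinomial≢0 n t h eq = ℕ.≢-nonZero⁻¹ (n !) {{n !≢0}} (begin
  n !                               ≡⟨ multinomialRec-*-fact4 n t h ⟨
  multinomialRec n t * fact4 t      ≡⟨ cong (_* fact4 t) (multinomial≡multinomialRec n t h) ⟨
  multinomial⁴ t * fact4 t          ≡⟨ cong (_* fact4 t) eq ⟩
  0                                 ∎)
  where open ≡-Reasoning

-- The eigenvalue

·ℕ-comm : ∀ {n} (b v : Vec ℤ₄ n) → b ·ℕ v ≡ v ·ℕ b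
·ℕ-comm []      []      = refl
·ℕ-comm (x ∷ b) (y ∷ v) = cong₂ _+_ (ℕ.*-comm (toℕ x) (toℕ y)) (·ℕ-comm b v)

ℕ⁴-eqᵇ⇒≡ : ∀ t u → T (ℕ⁴-eqᵇ t u) → t ≡ u
ℕ⁴-eqᵇ⇒≡ (a , b , c , d) (a' , b' , c' , d') h =
  let (ha , h₁) = to T-∧ h
      (hb , h₂) = to T-∧ h₁
      (hc , hd) = to T-∧ h₂
  in cong₂ _,_ (ℕ.≡ᵇ⇒≡ a a' ha)
       (cong₂ _,_ (ℕ.≡ᵇ⇒≡ b b' hb) (cong₂ _,_ (ℕ.≡ᵇ⇒≡ c c' hc) (ℕ.≡ᵇ⇒≡ d d' hd)))

∑-ofType-𝒦 : ∀ n t e → ∑ (λ v → 𝟙 (ofType t v) *ᵢ 𝒦 v e) (allVecs n) ≡ #ofType n t *ᵢ 𝒦ᵗ t e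
∑-ofType-𝒦 n t e = trans (∑-cong term (allVecs n)) (∑-*ʳ _ (𝒦ᵗ t e) (allVecs n))
  where
  term : ∀ v → 𝟙 (ofType t v) *ᵢ 𝒦 v e ≡ 𝟙 (ofType t v) *ᵢ 𝒦ᵗ t e
  term v with ofType t v in eq
  ... | true  = cong (1ᵢ *ᵢ_) (trans (𝒦≗𝒦ᵗ-typeOf v e)
                                     (cong (λ u → 𝒦ᵗ u e) (ℕ⁴-eqᵇ⇒≡ (typeOf v) t (from T-≡ eq))))
  ... | false = trans (ℤ[i].zeroˡ (𝒦 v e)) (sym (ℤ[i].zeroˡ (𝒦ᵗ t e)))

-- both sides count Σ ζ^{b·v} over pairs (b, v) of types (e, t)
#ofType-𝒦ᵗ-sym : ∀ n t e → #ofType n t *ᵢ 𝒦ᵗ t e ≡ #ofType n e *ᵢ 𝒦ᵗ e t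
#ofType-𝒦ᵗ-sym n t e = begin
  #ofType n t *ᵢ 𝒦ᵗ t e
    ≡⟨ ∑-ofType-𝒦 n t e ⟨
  ∑ (λ v → 𝟙 (ofType t v) *ᵢ 𝒦 v e) (allVecs n)
    ≡⟨ ∑-cong (λ v → ∑-*ˡ (𝟙 (ofType t v)) (λ b → 𝟙 (ofType e b) *ᵢ ζ (b ·ℕ v)) (allVecs n)) (allVecs n) ⟨
  ∑ (λ v → ∑ (λ b → 𝟙 (ofType t v) *ᵢ (𝟙 (ofType e b) *ᵢ ζ (b ·ℕ v))) (allVecs n)) (allVecs n)
    ≡⟨ ∑-comm _ (allVecs n) (allVecs n) ⟩
  ∑ (λ b → ∑ (λ v → 𝟙 (ofType t v) *ᵢ (𝟙 (ofType e b) *ᵢ ζ (b ·ℕ v))) (allVecs n)) (allVecs n)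
    ≡⟨ ∑-cong (λ b → ∑-cong (λ v → swap b v) (allVecs n)) (allVecs n) ⟩
  ∑ (λ b → ∑ (λ v → 𝟙 (ofType e b) *ᵢ (𝟙 (ofType t v) *ᵢ ζ (v ·ℕ b))) (allVecs n)) (allVecs n)
    ≡⟨ ∑-cong (λ b → ∑-*ˡ (𝟙 (ofType e b)) (λ v → 𝟙 (ofType t v) *ᵢ ζ (v ·ℕ b)) (allVecs n)) (allVecs n) ⟩
  ∑ (λ b → 𝟙 (ofType e b) *ᵢ 𝒦 b t) (allVecs n)
    ≡⟨ ∑-ofType-𝒦 n e t ⟩
  #ofType n e *ᵢ 𝒦ᵗ e t ∎
  where
  open ≡-Reasoning
  swap : ∀ b v → 𝟙 (ofType t v) *ᵢ (𝟙 (ofType e b) *ᵢ ζ (b ·ℕ v))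
               ≡ 𝟙 (ofType e b) *ᵢ (𝟙 (ofType t v) *ᵢ ζ (v ·ℕ b))
  swap b v = trans (ℤ[i].x∙yz≈y∙xz (𝟙 (ofType t v)) (𝟙 (ofType e b)) (ζ (b ·ℕ v)))
                   (cong (λ k → 𝟙 (ofType e b) *ᵢ (𝟙 (ofType t v) *ᵢ ζ k)) (·ℕ-comm b v))

multinomial-*-eigenvalue : ∀ n r s (v : Vec ℤ₄ n) → sum4 (r , s , r , s) ≡ n →
  ι (+ multinomial⁴ (typeOf v)) *ᵢ eigenvalue n r s v
  ≡ ι (+ multinomial r s r s) *ᵢ ι (coeff (eigenPoly r s) (typeOf v))
multinomial-*-eigenvalue n r s v h = begin
  ι (+ multinomial⁴ t) *ᵢ eigenvalue n r s v
    ≡⟨ cong₂ _*ᵢ_ (sym (#ofType≡multinomial n t (sum4-typeOf v))) (eigenvalue≡𝒦 n r s v) ⟩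
  #ofType n t *ᵢ 𝒦 v e
    ≡⟨ cong (#ofType n t *ᵢ_) (𝒦≗𝒦ᵗ-typeOf v e) ⟩
  #ofType n t *ᵢ 𝒦ᵗ t e
    ≡⟨ #ofType-𝒦ᵗ-sym n t e ⟩
  #ofType n e *ᵢ 𝒦ᵗ e t
    ≡⟨ cong₂ _*ᵢ_ (#ofType≡multinomial n e h) (𝒦ᵗ-coeff r s t) ⟩
  ι (+ multinomial r s r s) *ᵢ ι (coeff (eigenPoly r s) t) ∎
  where
  open ≡-Reasoning
  t e : ℕ⁴
  t = typeOf v
  e = (r , s , r , s)

cross-multiplication : ∀ x c m k → + suc k ℤ.* x ≡ + m ℤ.* c → x / 1 ≡ (+ m / suc k) *ℚ (c / 1)
cross-multiplication x c m k eq = ℚ.toℚᵘ-injective (begin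
  toℚᵘ (x / 1)
    ≈⟨ ℚ.toℚᵘ-fromℚᵘ (mkℚᵘ x 0) ⟩
  mkℚᵘ x 0
    ≈⟨ *≡* cross ⟩
  mkℚᵘ (+ m) k ℚᵘ.* mkℚᵘ c 0
    ≈⟨ ℚᵘ.*-cong (ℚ.toℚᵘ-fromℚᵘ (mkℚᵘ (+ m) k)) (ℚ.toℚᵘ-fromℚᵘ (mkℚᵘ c 0)) ⟨
  toℚᵘ (+ m / suc k) ℚᵘ.* toℚᵘ (c / 1)
    ≈⟨ ℚ.toℚᵘ-homo-* (+ m / suc k) (c / 1) ⟨
  toℚᵘ ((+ m / suc k) *ℚ (c / 1)) ∎)
  where
  open ℚᵘ.≃-Reasoning
  cross : x ℤ.* + suc (k * 1) ≡ (+ m ℤ.* c) ℤ.* + 1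
  cross = trans (cong (λ j → x ℤ.* + suc j) (ℕ.*-identityʳ k))
                (trans (ℤ.*-comm x (+ suc k)) (trans eq (sym (ℤ.*-identityʳ (+ m ℤ.* c)))))

scaled-equation⇒ : ∀ z {a b} c → a ≢ 0 → ι (+ a) *ᵢ z ≡ ι (+ b) *ᵢ ι c →
                   (proj₁ z / 1 ≡ (b ÷ℕ a) *ℚ (c / 1)) × proj₂ z ≡ 0ℤ
scaled-equation⇒ z {zero}  c a≢0 eq = ⊥-elim (a≢0 refl)
scaled-equation⇒ z {suc k} {b} c _ eq =
  cross-multiplication (proj₁ z) c b k (cong proj₁ components) ,
  ℤ.*-cancelˡ-≡ (+ suc k) (proj₂ z) 0ℤ (trans (cong proj₂ components) (sym (ℤ.*-zeroʳ (+ suc k))))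
  where
  components : (+ suc k ℤ.* proj₁ z , + suc k ℤ.* proj₂ z) ≡ (+ b ℤ.* c , 0ℤ)
  components = trans (sym (ι-scale (+ suc k) z)) (trans eq (sym (ι-* (+ b) c)))

theorem4 : (n m r : ℕ) → n ≡ 2 * m → n ≥ 2 → r ≤ m →
    (v : Vec ℤ₄ n) →
    let s = m ∸ r
        t = typeOf v
        t₀ = proj₁ t
        t₁ = proj₁ (proj₂ t)
        t₂ = proj₁ (proj₂ (proj₂ t))
        t₃ = proj₂ (proj₂ (proj₂ t))
        λv = eigenvalue n r s v
    in (proj₁ λv / 1 ≡ (multinomial r s r s ÷ℕ multinomial t₀ t₁ t₂ t₃) *ℚ (coeff (eigenPoly r s) t / 1))
       × proj₂ λv ≡ 0ℤ
theorem4 n m r n≡2m _ r≤m v =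
  scaled-equation⇒ (eigenvalue n r s v) (coeff (eigenPoly r s) (typeOf v))
    (multinomial≢0 n (typeOf v) (sum4-typeOf v))
    (multinomial-*-eigenvalue n r s v size)
  where
  s : ℕ
  s = m ∸ r
  size : sum4 (r , s , r , s) ≡ n
  size = begin
    r + s + r + s           ≡⟨ regroup r s ⟩
    (r + s) + ((r + s) + 0) ≡⟨ cong (λ k → k + (k + 0)) (ℕ.m+[n∸m]≡n r≤m) ⟩
    2 * m                   ≡⟨ n≡2m ⟨
    n                       ∎
    where
    open ≡-Reasoning
    regroup : ∀ r s → r + s + r + s ≡ (r + s) + ((r + s) + 0)
    regroup = ℕ-solve-∀
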